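{- Let $m$ be a matching on $[N]$. Then: (1) if a chord of $m$ intersects another chord of $m$, then it is stable; (2) a chord $(i,j)$ of $m$ with $i<j$ is stable if and only if some vertex in $\{i+1,\dots,j-1\}$ is stable; (3) if $i<j$, the interval $[i,j]$ is $m$-invariant, and the restriction $\mathrm{res}_{[i,j]}(m)$ is perfect and non-crossing, then no vertex $\ell\in[i,j]$ is stable.
   Context: A matching on a finite set $S\subseteq\mathbb{N}$ is a partition of $S$ into blocks of size 1 (unmatched vertices) or 2 (chords $(i,j)$); it is perfect if it has no unmatched vertices. Chords $(i_1,i_3)$ and $(i_2,i_4)$ with $i_1<i_2<i_3<i_4$ intersect; a matching is non-crossing if no two of its chords intersect. A set $S\subseteq[N]$ is $m$-invariant if for every chord $(a,b)$ of $m$, $a\in S\iff b\in S$; then $\mathrm{res}_S(m)$ is the matching on $S$ consisting of the blocks of $m$ contained in $S$. The reduction process of $m$ repeatedly deletes a chord whose two endpoints are consecutive among the currently remaining vertices (together with these two vertices), until no such chord exists. Chords and vertices deleted are unstable; those never deleted are stable (these sets do not depend on the choices made in the process). -}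

module Defs where

open import Data.Nat using (ℕ)
open import Data.Fin using (Fin; _<_; _≤_; _≟_)
open import Data.Bool using (Bool; true; false; if_then_else_; _∨_)
open import Data.Product using (Σ; _×_; ∃; ∃-syntax)
open import Data.Sum using (_⊎_)
open import Relation.Nullary using (¬_)
open import Relation.Nullary.Decidable using (⌊_⌋)
open import Relation.Binary.PropositionalEquality using (_≡_; _≢_)
open import Relation.Binary.Construct.Closure.ReflexiveTransitive using (Star)

-- The vertex set [N] is modelled by Fin N (0-based; only the order matters).
-- A matching on [N] is an involution: partner i = j means (i,j) is a chord,
-- partner i = i means i is unmatched.
record Matching (N : ℕ) : Set where
  field
    partner : Fin N → Fin N
    invol   : ∀ i → partner (partner i) ≡ i
open Matching public

IsChord : ∀ {N} → Matching N → Fin N → Fin N → Set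
IsChord m i j = (partner m i ≡ j) × (i < j)

-- chords (i,j) and (k,l) (written with smaller endpoint first) intersect
Intersect : ∀ {N} → Fin N → Fin N → Fin N → Fin N → Set
Intersect i j k l = (i < k × k < j × j < l) ⊎ (k < i × i < l × l < j)

VSet : ℕ → Set
VSet N = Fin N → Bool

full : ∀ {N} → VSet N
full _ = true

remove : ∀ {N} → Fin N → Fin N → VSet N → VSet N
remove a b R v = if (⌊ v ≟ a ⌋ ∨ ⌊ v ≟ b ⌋) then false else R v

Deletable : ∀ {N} → Matching N → VSet N → Fin N → Fin N → Set
Deletable m R a b =
  IsChord m a b × R a ≡ true × R b ≡ true ×
  (∀ c → a < c → c < b → R c ≡ false)

data Step {N : ℕ} (m : Matching N) : VSet N → VSet N → Set where
  del : ∀ {R} a b → Deletable m R a b → Step m R (remove a b R)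

Terminal : ∀ {N} → Matching N → VSet N → Set
Terminal m R = ∀ a b → ¬ Deletable m R a b

-- a vertex is stable if it is never deleted: it remains in the final set of
-- every complete run of the reduction process started from [N]
StableV : ∀ {N} → Matching N → Fin N → Set
StableV m v = ∀ T → Star (Step m) full T → Terminal m T → T v ≡ true

-- a chord is stable if it is never deleted (i.e. its endpoints are never deleted;
-- both endpoints are deleted simultaneously)
StableChord : ∀ {N} → Matching N → Fin N → Fin N → Set
StableChord m i j = StableV m i × StableV m j

InI : ∀ {N} → Fin N → Fin N → Fin N → Set
InI i j v = i ≤ v × v ≤ j

Invariant : ∀ {N} → Matching N → Fin N → Fin N → Set
Invariant m i j = ∀ a b → partner m a ≡ b →
  (InI i j a → InI i j b) × (InI i j b → InI i j a)

PerfectOn : ∀ {N} → Matching N → Fin N → Fin N → Set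
PerfectOn m i j = ∀ a → InI i j a → partner m a ≢ a

NonCrossingOn : ∀ {N} → Matching N → Fin N → Fin N → Set
NonCrossingOn m i j = ∀ a b c d →
  InI i j a → InI i j b → InI i j c → InI i j d →
  IsChord m a b → IsChord m c d → ¬ Intersect a b c d

-- Deleting a chord (a,b) needs every vertex strictly between a and b to be gone already, so a
-- chord with a remaining vertex inside it survives the step; two crossing chords guard each
-- other forever, and a chord guarded by a stable vertex is stable. Conversely the reduction
-- process is terminating and has the diamond property (distinct deletable chords stay
-- deletable after each other's deletion), so all complete runs end in the same set. In that
-- set a remaining chord must enclose a remaining vertex, which is stable; and in a perfect
-- non-crossing invariant interval the partner of that vertex lies inside the chord too, giving
-- a strictly nested remaining chord, so no chord of the interval can remain.
module Submission where

open import Defs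
open import Data.Nat using (ℕ)
import Data.Nat as ℕ
import Data.Nat.Induction as ℕ
import Data.Nat.Properties as ℕ
open import Data.Fin using (Fin; _<_; _≟_; _<?_)
open import Data.Fin.Properties using (<-asym; <-irrefl; <-cmp; any?; all?)
import Data.Fin.Induction as Fin
open import Data.Fin.Subset using (_∈_; ∣_∣)
open import Data.Fin.Subset.Properties using (p⊂q⇒∣p∣<∣q∣)
open import Data.Vec using (tabulate)
open import Data.Vec.Properties using (lookup∘tabulate; []=⇒lookup; lookup⇒[]=)
open import Data.Bool using (true; false; _∨_)
import Data.Bool as Bool
open import Data.Bool.Properties using (¬-not; not-¬)
open import Data.Product using (_×_; ∃-syntax; _,_; proj₁; proj₂)
open import Data.Sum using (_⊎_; inj₁; inj₂)
open import Data.Empty using (⊥-elim)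
open import Function.Base using (_∘_; id; _on_)
open import Function.Bundles using (_⇔_; mk⇔)
open import Induction.WellFounded using (WellFounded; Acc; acc)
import Relation.Binary.Construct.On as On
open import Relation.Binary.Definitions using (tri<; tri≈; tri>)
open import Relation.Binary.PropositionalEquality
open import Relation.Binary.Construct.Closure.ReflexiveTransitive using (Star; ε; _◅_; fold)
open import Relation.Nullary using (¬_; Dec; yes; no; contradiction)
open import Relation.Nullary.Decidable using (⌊_⌋; _×-dec_; _→-dec_)

private variable
  N : ℕ
  R R' : VSet N
  a b c f v : Fin N

remove-left : (a b : Fin N) (R : VSet N) → remove a b R a ≡ false
remove-left a b R with a ≟ a
... | yes _   = refl
... | no a≢a = contradiction refl a≢a

remove-right : (a b : Fin N) (R : VSet N) → remove a b R b ≡ false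
remove-right a b R with b ≟ a | b ≟ b
... | yes _ | _       = refl
... | no _  | yes _   = refl
... | no _  | no b≢b = contradiction refl b≢b

remove-other : (R : VSet N) → v ≢ a → v ≢ b → remove a b R v ≡ R v
remove-other {v = v} {a} {b} R v≢a v≢b with v ≟ a | v ≟ b
... | yes v≡a | _       = contradiction v≡a v≢a
... | no _    | yes v≡b = contradiction v≡b v≢b
... | no _    | no _    = refl

remove-⊆ : (a b : Fin N) (R : VSet N) → remove a b R v ≡ true → R v ≡ true
remove-⊆ {v = v} a b R with ⌊ v ≟ a ⌋ ∨ ⌊ v ≟ b ⌋
... | true  = λ ()
... | false = id

remove-false : (a b : Fin N) (R : VSet N) → R v ≡ false → remove a b R v ≡ false
remove-false {v = v} a b R with ⌊ v ≟ a ⌋ ∨ ⌊ v ≟ b ⌋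
... | true  = λ _ → refl
... | false = id

remove-cong : (a b : Fin N) → R ≗ R' → remove a b R ≗ remove a b R'
remove-cong a b R≗R' v with ⌊ v ≟ a ⌋ ∨ ⌊ v ≟ b ⌋
... | true  = refl
... | false = R≗R' v

remove-comm : (a b c f : Fin N) (R : VSet N) →
  remove a b (remove c f R) ≗ remove c f (remove a b R)
remove-comm a b c f R v with ⌊ v ≟ a ⌋ ∨ ⌊ v ≟ b ⌋ | ⌊ v ≟ c ⌋ ∨ ⌊ v ≟ f ⌋
... | true  | true  = refl
... | true  | false = refl
... | false | true  = refl
... | false | false = refl

size : VSet N → ℕ
size R = ∣ tabulate R ∣

∈-tabulate⁺ : {R : VSet N} {v : Fin N} → R v ≡ true → v ∈ tabulate R
∈-tabulate⁺ {R = R} {v} Rv = lookup⇒[]= v (tabulate R) (trans (lookup∘tabulate R v) Rv)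

∈-tabulate⁻ : {R : VSet N} {v : Fin N} → v ∈ tabulate R → R v ≡ true
∈-tabulate⁻ {R = R} {v} v∈R = trans (sym (lookup∘tabulate R v)) ([]=⇒lookup v∈R)

size-remove-< : (a b : Fin N) (R : VSet N) → R a ≡ true → size (remove a b R) ℕ.< size R
size-remove-< a b R Ra = p⊂q⇒∣p∣<∣q∣
  ( ∈-tabulate⁺ ∘ remove-⊆ a b R ∘ ∈-tabulate⁻
  , a , ∈-tabulate⁺ Ra , not-¬ (remove-left a b R) ∘ ∈-tabulate⁻ )

_⊏_ : VSet N → VSet N → Set
_⊏_ = ℕ._<_ on size

⊏-wellFounded : WellFounded (_⊏_ {N})
⊏-wellFounded = On.wellFounded size ℕ.<-wellFounded

ChordPresent : VSet N → Fin N → Fin N → Set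
ChordPresent R i j = R i ≡ true × R j ≡ true

HasInner : VSet N → Fin N → Fin N → Set
HasInner R i j = ∃[ v ] (i < v × v < j × R v ≡ true)

intersect-sym : {i j k l : Fin N} → Intersect i j k l → Intersect k l i j
intersect-sym (inj₁ i<k<j<l) = inj₂ i<k<j<l
intersect-sym (inj₂ k<i<l<j) = inj₁ k<i<l<j

intersect-inner : {i j k l : Fin N} → Intersect i j k l → ChordPresent R k l → HasInner R i j
intersect-inner (inj₁ (i<k , k<j , _)) (Rk , _)  = _ , i<k , k<j , Rk
intersect-inner (inj₂ (_ , i<l , l<j)) (_ , Rl) = _ , i<l , l<j , Rl

module _ (m : Matching N) where

  private variable
    T T' : VSet N
    i j : Fin N

  partner-sym : partner m a ≡ b → partner m b ≡ a
  partner-sym {a} refl = invol m a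

  distinct-chords-disjoint : IsChord m a b → IsChord m i j → a ≢ i →
    i ≢ a × i ≢ b × j ≢ a × j ≢ b
  distinct-chords-disjoint {a} {b} {i} {j} (pa , a<b) (pi , i<j) a≢i =
      a≢i ∘ sym
    , (λ { refl → <-asym a<b (subst (i <_) (trans (sym pi) (partner-sym pa)) i<j) })
    , (λ { refl → <-asym a<b (subst (_< a) (trans (sym (partner-sym pi)) pa) i<j) })
    , (λ { refl → a≢i (trans (sym (partner-sym pa)) (partner-sym pi)) })

  remove-other-chord : Deletable m R a b → IsChord m i j → a ≢ i →
    remove a b R i ≡ R i × remove a b R j ≡ R j
  remove-other-chord {R = R} (ab , _) ij a≢i with distinct-chords-disjoint ab ij a≢i
  ... | i≢a , i≢b , j≢a , j≢b = remove-other R i≢a i≢b , remove-other R j≢a j≢b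

  deletable? : (R : VSet N) (a b : Fin N) → Dec (Deletable m R a b)
  deletable? R a b =
    ((partner m a ≟ b) ×-dec (a <? b)) ×-dec (R a Bool.≟ true) ×-dec (R b Bool.≟ true)
    ×-dec all? (λ c → (a <? c) →-dec ((c <? b) →-dec (R c Bool.≟ false)))

  Deletable-cong : R ≗ R' → Deletable m R a b → Deletable m R' a b
  Deletable-cong {a = a} {b} R≗R' (ab , Ra , Rb , gap) =
    ab , trans (sym (R≗R' a)) Ra , trans (sym (R≗R' b)) Rb ,
    λ c a<c c<b → trans (sym (R≗R' c)) (gap c a<c c<b)

  Deletable-remove : Deletable m R a b → Deletable m R c f → c ≢ a →
    Deletable m (remove c f R) a b
  Deletable-remove {R = R} {c = c} {f} d@(ab , Ra , Rb , gap) d' c≢a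
    with remove-other-chord d' ab c≢a
  ... | keep-a , keep-b =
    ab , trans keep-a Ra , trans keep-b Rb , λ x a<x x<b → remove-false c f R (gap x a<x x<b)

  terminal-inner : Terminal m T → IsChord m i j → ChordPresent T i j → HasInner T i j
  terminal-inner {T} {i} {j} terminal ij (Ti , Tj)
    with any? (λ v → (i <? v) ×-dec (v <? j) ×-dec (T v Bool.≟ true))
  ... | yes inner = inner
  ... | no no-inner =
    ⊥-elim (terminal i j (ij , Ti , Tj , λ v i<v v<j → ¬-not (λ Tv → no-inner (v , i<v , v<j , Tv))))

  step-keeps-guarded-chord : Step m R R' → IsChord m i j → HasInner R i j →
    ChordPresent R i j → ChordPresent R' i j
  step-keeps-guarded-chord {i = i} (del a b d@((pa , _) , _ , _ , gap)) (pi , i<j)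
                           (v , i<v , v<j , Rv) (Ri , Rj) with a ≟ i
  ... | yes refl = contradiction (gap v i<v (subst (v <_) (trans (sym pi) pa) v<j)) (not-¬ Rv)
  ... | no a≢i with remove-other-chord d (pi , i<j) a≢i
  ...   | keep-i , keep-j = trans keep-i Ri , trans keep-j Rj

  step-⊆ : Step m R R' → R' v ≡ true → R v ≡ true
  step-⊆ {v = v} (del {R} a b _) = remove-⊆ {v = v} a b R

  star-preserves : (P : VSet N → Set) → (∀ {R R'} → Step m R R' → P R → P R') →
    Star (Step m) R T → P R → P T
  star-preserves P preserve = fold (λ R T → P R → P T) (λ s k → k ∘ preserve s) id

  terminating-run : (R : VSet N) → ∃[ T ] (Star (Step m) R T × Terminal m T)
  terminating-run R = run R (⊏-wellFounded R)
    where
    run : (R : VSet N) → Acc _⊏_ R → ∃[ T ] (Star (Step m) R T × Terminal m T)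
    run R (acc smaller) with any? (λ a → any? (λ b → deletable? R a b))
    ... | no stuck = R , ε , λ a b d → stuck (a , b , d)
    ... | yes (a , b , d@(_ , Ra , _)) with run (remove a b R) (smaller (size-remove-< a b R Ra))
    ...   | T , run , terminal = T , del a b d ◅ run , terminal

  run-cong : R ≗ R' → Star (Step m) R T → Terminal m T →
    ∃[ T' ] (Star (Step m) R' T' × Terminal m T' × T ≗ T')
  run-cong R≗R' ε terminal =
    _ , ε , (λ a b d → terminal a b (Deletable-cong (sym ∘ R≗R') d)) , R≗R'
  run-cong R≗R' (del a b d ◅ run) terminal with run-cong (remove-cong a b R≗R') run terminal
  ... | T' , run' , terminal' , T≗T' = T' , del a b (Deletable-cong R≗R' d) ◅ run' , terminal' , T≗T'

  normal-form-unique : Acc _⊏_ R → Star (Step m) R T → Terminal m T →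
    Star (Step m) R T' → Terminal m T' → T ≗ T'
  normal-form-unique _ ε _ ε _ = λ _ → refl
  normal-form-unique _ ε terminal (del a b d ◅ _) _ = ⊥-elim (terminal a b d)
  normal-form-unique _ (del a b d ◅ _) _ ε terminal' = ⊥-elim (terminal' a b d)
  normal-form-unique {R = R} (acc smaller) (del a b d ◅ run) terminal (del c f d' ◅ run') terminal'
    with a ≟ c
  ... | yes refl with trans (sym (proj₁ (proj₁ d))) (proj₁ (proj₁ d'))
  ...   | refl = normal-form-unique (smaller (size-remove-< a b R (proj₁ (proj₂ d)))) run terminal run' terminal'
  normal-form-unique {R = R} (acc smaller) (del a b d ◅ run) terminal (del c f d' ◅ run') terminal'
      | no a≢c
    -- the two first steps commute, so both runs are compared with one through the common successor
    with terminating-run (remove c f (remove a b R))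
  ... | T₃ , run₃ , terminal₃ with run-cong (remove-comm c f a b R) run₃ terminal₃
  ...   | T₄ , run₄ , terminal₄ , T₃≗T₄ = λ v → trans (T≗T₃ v) (trans (T₃≗T₄ v) (T₄≗T' v))
    where
    T≗T₃ = normal-form-unique (smaller (size-remove-< a b R (proj₁ (proj₂ d))))
      run terminal (del c f (Deletable-remove d' d a≢c) ◅ run₃) terminal₃
    T₄≗T' = normal-form-unique (smaller (size-remove-< c f R (proj₁ (proj₂ d'))))
      (del a b (Deletable-remove d d' (a≢c ∘ sym)) ◅ run₄) terminal₄ run' terminal'

  normal-form-stable : Star (Step m) full T → Terminal m T → T v ≡ true → StableV m v
  normal-form-stable {v = v} run terminal Tv T' run' terminal' =
    trans (sym (normal-form-unique (⊏-wellFounded full) run terminal run' terminal' v)) Tv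

  PartnerClosed : VSet N → Set
  PartnerClosed R = ∀ v → R (partner m v) ≡ R v

  step-partnerClosed : Step m R R' → PartnerClosed R → PartnerClosed R'
  step-partnerClosed {R = R} (del a b ((pa , _) , _)) closed v with v ≟ a | v ≟ b
  ... | yes refl | _        = trans (cong (remove a b R) pa) (remove-right a b R)
  ... | no _     | yes refl = trans (cong (remove a b R) (partner-sym pa)) (remove-left a b R)
  ... | no v≢a   | no v≢b   = trans (remove-other R pv≢a pv≢b) (closed v)
    where
    pv≢a : partner m v ≢ a
    pv≢a pv≡a = v≢b (trans (sym (partner-sym pv≡a)) pa)
    pv≢b : partner m v ≢ b
    pv≢b pv≡b = v≢a (trans (sym (partner-sym pv≡b)) (partner-sym pa))

  reachable-partnerClosed : Star (Step m) full T → PartnerClosed T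
  reachable-partnerClosed run = star-preserves PartnerClosed step-partnerClosed run (λ _ → refl)

  chord-orient : partner m v ≢ v → IsChord m v (partner m v) ⊎ IsChord m (partner m v) v
  chord-orient {v} pv≢v with <-cmp v (partner m v)
  ... | tri< v<pv _ _ = inj₁ (refl , v<pv)
  ... | tri≈ _ v≡pv _ = contradiction (sym v≡pv) pv≢v
  ... | tri> _ _ pv<v = inj₂ (invol m v , pv<v)

  module _ {i j : Fin N} (invariant : Invariant m i j) (perfect : PerfectOn m i j)
           (non-crossing : NonCrossingOn m i j) where

    partner-∈ : InI i j v → InI i j (partner m v)
    partner-∈ {v} = proj₁ (invariant v _ refl)

    partner-inside-chord : IsChord m a b → InI i j a → InI i j b → InI i j v →
      a < v → v < b → a < partner m v × partner m v < b
    partner-inside-chord {a} {b} {v} ab@(pa , _) a∈ b∈ v∈ a<v v<b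
      with <-cmp (partner m v) b
    ... | tri≈ _ pv≡b _ = contradiction a<v (<-irrefl (trans (sym (partner-sym pa)) (partner-sym pv≡b)))
    ... | tri> _ _ b<pv = contradiction (inj₁ (a<v , v<b , b<pv))
      (non-crossing a b v _ a∈ b∈ v∈ (partner-∈ v∈) ab (refl , ℕ.<-trans v<b b<pv))
    ... | tri< pv<b _ _ with <-cmp a (partner m v)
    ...   | tri< a<pv _ _ = a<pv , pv<b
    ...   | tri≈ _ a≡pv _ = contradiction v<b (<-irrefl (trans (sym (partner-sym (sym a≡pv))) pa))
    ...   | tri> _ _ pv<a = contradiction (inj₂ (pv<a , a<v , v<b))
      (non-crossing a b _ v a∈ b∈ (partner-∈ v∈) v∈ ab (invol m v , ℕ.<-trans pv<a a<v))

    between-∈ : InI i j a → InI i j b → a < v → v < b → InI i j v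
    between-∈ (i≤a , _) (_ , b≤j) a<v v<b = ℕ.≤-trans i≤a (ℕ.<⇒≤ a<v) , ℕ.<⇒≤ (ℕ.<-≤-trans v<b b≤j)

    partnerClosed-chord : PartnerClosed T → IsChord m a b → T b ≡ true → ChordPresent T a b
    partnerClosed-chord {T} {b = b} closed (pa , _) Tb =
      trans (cong T (sym (partner-sym pa))) (trans (closed b) Tb) , Tb

    no-present-chord : Terminal m T → PartnerClosed T → IsChord m a b →
      InI i j a → InI i j b → T b ≢ true
    no-present-chord {T} terminal closed = go (Fin.<-wellFounded _)
      where
      go : ∀ {a b} → Acc _<_ b → IsChord m a b → InI i j a → InI i j b → T b ≢ true
      go (acc smaller) ab a∈ b∈ Tb
        with terminal-inner terminal ab (partnerClosed-chord closed ab Tb)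
      ... | v , a<v , v<b , Tv with between-∈ a∈ b∈ a<v v<b
      ...   | v∈ with partner-inside-chord ab a∈ b∈ v∈ a<v v<b | chord-orient (perfect v v∈)
      ...     | _ , pv<b | inj₁ v-pv = go (smaller pv<b) v-pv v∈ (partner-∈ v∈) (trans (closed v) Tv)
      ...     | _ , _    | inj₂ pv-v = go (smaller v<b) pv-v (partner-∈ v∈) v∈ Tv

    interval-unstable : InI i j v → ¬ StableV m v
    interval-unstable {v} v∈ stable with terminating-run full
    ... | T , run , terminal with chord-orient (perfect v v∈) | reachable-partnerClosed run
    ...   | inj₁ v-pv | closed =
      no-present-chord terminal closed v-pv v∈ (partner-∈ v∈) (trans (closed v) (stable T run terminal))
    ...   | inj₂ pv-v | closed =
      no-present-chord terminal closed pv-v (partner-∈ v∈) v∈ (stable T run terminal)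

  stableChord-intro : (∀ T → Star (Step m) full T → Terminal m T → ChordPresent T i j) →
    StableChord m i j
  stableChord-intro present = (λ T run terminal → proj₁ (present T run terminal))
                            , (λ T run terminal → proj₂ (present T run terminal))

  crossing-chord-stable : {k l : Fin N} → IsChord m i j → IsChord m k l → Intersect i j k l →
    StableChord m i j
  crossing-chord-stable {i} {j} {k} {l} ij kl crossing = stableChord-intro λ T run _ →
    proj₁ (star-preserves (λ R → ChordPresent R i j × ChordPresent R k l) keep run ((refl , refl) , (refl , refl)))
    where
    keep : Step m R R' → ChordPresent R i j × ChordPresent R k l → ChordPresent R' i j × ChordPresent R' k l
    keep s (ij-present , kl-present) =
        step-keeps-guarded-chord s ij (intersect-inner crossing kl-present) ij-present
      , step-keeps-guarded-chord s kl (intersect-inner (intersect-sym crossing) ij-present) kl-present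

  inner-stable⇒chord-stable : IsChord m i j → ∃[ v ] (i < v × v < j × StableV m v) → StableChord m i j
  inner-stable⇒chord-stable {i} {j} ij (v , i<v , v<j , stable) = stableChord-intro λ T run terminal →
    star-preserves (λ R → R v ≡ true → ChordPresent R i j) keep run (λ _ → refl , refl) (stable T run terminal)
    where
    keep : Step m R R' → (R v ≡ true → ChordPresent R i j) → R' v ≡ true → ChordPresent R' i j
    keep s present R'v = step-keeps-guarded-chord s ij (v , i<v , v<j , step-⊆ s R'v) (present (step-⊆ s R'v))

  chord-stable⇒inner-stable : IsChord m i j → StableChord m i j → ∃[ v ] (i < v × v < j × StableV m v)
  chord-stable⇒inner-stable ij (i-stable , j-stable) with terminating-run full
  ... | T , run , terminal with terminal-inner terminal ij (i-stable T run terminal , j-stable T run terminal)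
  ...   | v , i<v , v<j , Tv = v , i<v , v<j , normal-form-stable run terminal Tv

lemma4p6 : ∀ {N : ℕ} (m : Matching N) →
    (∀ i j k l → IsChord m i j → IsChord m k l → Intersect i j k l → StableChord m i j)
    × (∀ i j → IsChord m i j → StableChord m i j ⇔ (∃[ v ] (i < v × v < j × StableV m v)))
    × (∀ i j → i < j → Invariant m i j → PerfectOn m i j → NonCrossingOn m i j →
         ∀ l → InI i j l → ¬ StableV m l)
lemma4p6 m =
    (λ _ _ _ _ → crossing-chord-stable m)
  , (λ _ _ ij → mk⇔ (chord-stable⇒inner-stable m ij) (inner-stable⇒chord-stable m ij))
  , (λ _ _ _ invariant perfect non-crossing _ → interval-unstable m invariant perfect non-crossing)
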